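{- Let $t\geq 2$ and let $a_3,a_4,\dots,a_{2t}\geq 0$ be integers. Let $G$ be the disjoint union of $a_i$ copies of the cycle $C_i$ for each $i\in\{3,\dots,2t\}$, and let $n=\sum_{i=3}^{2t} i\,a_i$ be its order; assume $n\geq 6$. (1) If $n$ is even and $a_5+a_7+\dots+a_{2t-1}=a_3$, then $G^c$ is an extremal $(r|\chi)$-graph (for its own regularity $r$ and chromatic number $\chi$). (2) If $n$ is odd and $a_5+a_7+\dots+a_{2t-1}=a_3+1$, then $G^c$ is an extremal $(r|\chi)$-graph (for its own regularity $r$ and chromatic number $\chi$).
   Context: An $(r|\chi)$-graph is a simple finite $r$-regular graph with chromatic number $\chi$; it is extremal if it has the minimum possible order among all $(r|\chi)$-graphs. $G^c$ denotes the complement of $G$; it is $(n-3)$-regular. -}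

module Defs where

open import Data.Nat using (ℕ; zero; suc; _+_; _*_; _∸_; _≤_; _≡ᵇ_)
open import Data.Bool using (Bool; true; false; T; _∨_; _∧_; not; if_then_else_)
open import Data.Fin using (Fin; toℕ; splitAt)
open import Data.List using (List; []; _∷_; map; upTo; allFin; concatMap; replicate)
open import Data.Nat.ListAction using (sum)
open import Data.Sum using (inj₁; inj₂)
open import Data.Product using (_×_; Σ)
open import Relation.Binary.PropositionalEquality using (_≡_; _≢_)

Graph : ℕ → Set
Graph n = Fin n → Fin n → Bool

IsSimple : ∀ {n} → Graph n → Set
IsSimple {n} G = (∀ (u v : Fin n) → G u v ≡ G v u) × (∀ (u : Fin n) → G u u ≡ false)

degree : ∀ {n} → Graph n → Fin n → ℕ
degree {n} G v = sum (map (λ w → if G v w then 1 else 0) (allFin n))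

IsRegular : ℕ → ∀ {n} → Graph n → Set
IsRegular r {n} G = ∀ (v : Fin n) → degree G v ≡ r

Colourable : ℕ → ∀ {n} → Graph n → Set
Colourable k {n} G = Σ (Fin n → Fin k) (λ c → ∀ (u v : Fin n) → T (G u v) → c u ≢ c v)

ChromaticNumber : ℕ → ∀ {n} → Graph n → Set
ChromaticNumber χ G = Colourable χ G × (∀ k → Colourable k G → χ ≤ k)

IsRChiGraph : ℕ → ℕ → ∀ {n} → Graph n → Set
IsRChiGraph r χ G = IsSimple G × IsRegular r G × ChromaticNumber χ G

IsExtremal : ℕ → ℕ → ∀ {n} → Graph n → Set
IsExtremal r χ {n} G = IsRChiGraph r χ G × (∀ m (H : Graph m) → IsRChiGraph r χ H → n ≤ m)

complement : ∀ {n} → Graph n → Graph n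
complement {n} G u v = not (G u v) ∧ not (toℕ u ≡ᵇ toℕ v)

-- Cycle C_i on vertices 0..i-1 (used for i ≥ 3): j ~ j+1 and 0 ~ i-1.
cycle : (i : ℕ) → Graph i
cycle i j k = (suc (toℕ j) ≡ᵇ toℕ k) ∨ (suc (toℕ k) ≡ᵇ toℕ j)
              ∨ ((suc (toℕ j + toℕ k) ≡ᵇ i) ∧ ((toℕ j ≡ᵇ 0) ∨ (toℕ k ≡ᵇ 0)))

_⊕_ : ∀ {m n} → Graph m → Graph n → Graph (m + n)
_⊕_ {m} G H u v with splitAt m u | splitAt m v
... | inj₁ i | inj₁ j = G i j
... | inj₂ i | inj₂ j = H i j
... | inj₁ _ | inj₂ _ = false
... | inj₂ _ | inj₁ _ = false

cycles : (ls : List ℕ) → Graph (sum ls)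
cycles [] ()
cycles (l ∷ ls) = cycle l ⊕ cycles ls

cycleLengths : ℕ → (ℕ → ℕ) → List ℕ
cycleLengths t a = concatMap (λ i → replicate (a i) i) (map (λ k → 3 + k) (upTo (2 * t ∸ 2)))

order : ℕ → (ℕ → ℕ) → ℕ
order t a = sum (map (λ k → (3 + k) * a (3 + k)) (upTo (2 * t ∸ 2)))

oddSum : ℕ → (ℕ → ℕ) → ℕ
oddSum t a = sum (map (λ k → a (5 + 2 * k)) (upTo (t ∸ 2)))

module Submission where

-- G is
-- 2-regular, so its complement is (n - 3)-regular.  A proper colouring of the
-- complement is the same as a partition of G into cliques, and a clique of G
-- lies inside one cycle: C_3 is a single clique, while C_l (l ≥ 4) needs
-- exactly ⌈l/2⌉ cliques (an explicit cover gives the upper bound; a set of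
-- vertices that every cover must colour injectively gives the lower bound).
-- Hence χ = Σ κ(l) with κ(3) = 1 and κ(l) = ⌈l/2⌉.  Minimality follows from a
-- general order bound: an (r|χ)-graph with χ ≤ r and r + 3 ≤ 2χ has at least
-- r + 3 vertices, since a smaller one has a complement of degree 0 (it is
-- complete and needs r + 1 > χ colours) or 1 (a perfect matching, so it is
-- coloured by the (r + 2)/2 < χ matching pairs).  Finally 2χ + a_3 equals
-- n + (a_5 + a_7 + … + a_{2t-1}), so the hypotheses of the theorem say
-- 2χ = n resp. 2χ = n + 1, which with n ≥ 6 gives χ ≤ n - 3 and n ≤ 2χ.

open import Defs
open import Data.Nat using (ℕ; zero; suc; _+_; _*_; _∸_; _≤_; _<_; _%_; _≡ᵇ_; z≤n; s≤s; ⌊_/2⌋; ⌈_/2⌉)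
open import Data.Nat.Properties
open import Data.Nat.Tactic.RingSolver using (solve-∀)
open import Algebra.Properties.CommutativeMonoid.Sum +-0-commutativeMonoid
  using (sum-syntax; sum-cong-≗; ∑-distrib-+; sum-replicate-zero)
open import Data.Bool using (Bool; true; false; T; _∨_; _∧_; not; if_then_else_)
open import Data.Bool.Properties using (T-∨; T-∧; ∧-zeroʳ)
open import Data.Fin using (Fin; toℕ; splitAt; _↑ˡ_; _↑ʳ_; fromℕ<; fromℕ; inject₁)
  renaming (zero to fzero; suc to fsuc; _≟_ to _≟ᶠ_)
open import Data.Fin.Properties
  using (toℕ-injective; toℕ<n; toℕ-fromℕ<; toℕ-↑ˡ; toℕ-↑ʳ; ↑ˡ-injective; ↑ʳ-injective;
         splitAt-↑ˡ; splitAt-↑ʳ; splitAt⁻¹-↑ˡ; splitAt⁻¹-↑ʳ; injective⇒≤;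
         toℕ-fromℕ; toℕ-inject₁; inject₁-injective)
open import Data.List using (List; []; _∷_; _++_; map; tabulate; applyUpTo; replicate; upTo; concatMap)
open import Data.List.Properties using (map-tabulate; map-++; map-upTo; map-∘; map-id)
open import Data.List.Relation.Unary.All using (All; []; _∷_)
open import Data.List.Relation.Unary.All.Properties using (concat⁺; map⁺; applyUpTo⁺₂; replicate⁺)
open import Data.Nat.ListAction using (sum)
open import Data.Nat.ListAction.Properties using (sum-++)
open import Data.Sum using (_⊎_; inj₁; inj₂; [_,_])
open import Data.Product using (_×_; Σ; _,_; proj₁; proj₂; ∃-syntax)
open import Data.Empty using (⊥; ⊥-elim)
open import Data.Unit using (tt)
open import Function using (_∘_; id; Equivalence)
open import Relation.Binary.PropositionalEquality hiding ([_])
open import Relation.Nullary using (¬_; yes; no)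
open import Relation.Nullary.Decidable using (T?)

T-∨-elim : ∀ x {y} → T (x ∨ y) → T x ⊎ T y
T-∨-elim x = Equivalence.to (T-∨ {x})

T-∨-introˡ : ∀ {x} y → T x → T (x ∨ y)
T-∨-introˡ {x} y = Equivalence.from (T-∨ {x} {y}) ∘ inj₁

T-∨-introʳ : ∀ x {y} → T y → T (x ∨ y)
T-∨-introʳ x = Equivalence.from (T-∨ {x}) ∘ inj₂

not-T : ∀ {b} → T (not b) → ¬ T b
not-T {true} ()

T-not : ∀ {b} → ¬ T b → T (not b)
T-not {true}  h = h tt
T-not {false} h = tt

T-ext : ∀ {x y} → (T x → T y) → (T y → T x) → x ≡ y
T-ext {true}  {true}  _ _ = refl
T-ext {true}  {false} f _ = ⊥-elim (f tt)
T-ext {false} {true}  _ g = ⊥-elim (g tt)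
T-ext {false} {false} _ _ = refl

_==_ : ∀ {n} → Fin n → Fin n → Bool
u == v = toℕ u ≡ᵇ toℕ v

==⇒≡ : ∀ {n} {u v : Fin n} → T (u == v) → u ≡ v
==⇒≡ {u = u} {v} t = toℕ-injective (≡ᵇ⇒≡ (toℕ u) (toℕ v) t)

≡⇒== : ∀ {n} {u v : Fin n} → u ≡ v → T (u == v)
≡⇒== {u = u} {v} u≡v = ≡⇒≡ᵇ (toℕ u) (toℕ v) (cong toℕ u≡v)

==-refl : ∀ {n} (u : Fin n) → (u == u) ≡ true
==-refl fzero    = refl
==-refl (fsuc u) = ==-refl u

==-sym : ∀ {n} (u v : Fin n) → (u == v) ≡ (v == u)
==-sym fzero    fzero    = refl
==-sym fzero    (fsuc v) = refl
==-sym (fsuc u) fzero    = refl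
==-sym (fsuc u) (fsuc v) = ==-sym u v

-- Counting.  Degrees are counts of Boolean predicates on Fin n; everything
-- we need about counts follows from additivity over disjoint predicates.

ind : Bool → ℕ
ind b = if b then 1 else 0

count : ∀ {n} → (Fin n → Bool) → ℕ
count {n} P = ∑[ i < n ] ind (P i)

sum-tabulate : ∀ {n} (f : Fin n → ℕ) → sum (tabulate f) ≡ ∑[ i < n ] f i
sum-tabulate {zero}  f = refl
sum-tabulate {suc n} f = cong (f fzero +_) (sum-tabulate (f ∘ fsuc))

degree≡count : ∀ {n} (G : Graph n) v → degree G v ≡ count (G v)
degree≡count G v = trans (cong sum (map-tabulate id (ind ∘ G v))) (sum-tabulate (ind ∘ G v))

count-∨ : ∀ {n} (P Q : Fin n → Bool) → (∀ w → T (P w) → T (Q w) → ⊥) →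
          count (λ w → P w ∨ Q w) ≡ count P + count Q
count-∨ {n} P Q disjoint =
  trans (sum-cong-≗ {n} (λ w → ind-∨ (P w) (Q w) (disjoint w))) (∑-distrib-+ (ind ∘ P) (ind ∘ Q))
  where
  ind-∨ : ∀ x y → (T x → T y → ⊥) → ind (x ∨ y) ≡ ind x + ind y
  ind-∨ true  true  d = ⊥-elim (d tt tt)
  ind-∨ true  false d = refl
  ind-∨ false y     d = refl

count-cong : ∀ {n} {P Q : Fin n → Bool} → (∀ w → P w ≡ Q w) → count P ≡ count Q
count-cong {n} P≗Q = sum-cong-≗ {n} (cong ind ∘ P≗Q)

count-all : ∀ {n} (P : Fin n → Bool) → (∀ w → T (P w)) → count P ≡ n
count-all {zero}  P all = refl
count-all {suc n} P all with P fzero | all fzero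
... | true | _ = cong suc (count-all (P ∘ fsuc) (all ∘ fsuc))

count-empty : ∀ {n} (P : Fin n → Bool) → (∀ w → P w ≡ false) → count P ≡ 0
count-empty {n} P empty = trans (count-cong empty) (sum-replicate-zero n)

count-single : ∀ {n} (v : Fin n) → count (v ==_) ≡ 1
count-single {suc n} fzero    = cong suc (sum-replicate-zero n)
count-single {suc n} (fsuc v) = count-single v

count-none : ∀ {n} (P : Fin n → Bool) → count P ≡ 0 → ∀ w → ¬ T (P w)
count-none {suc n} P c fzero    t with P fzero
count-none {suc n} P () fzero   t | true
count-none {suc n} P c (fsuc w) t = count-none (P ∘ fsuc) (m+n≡0⇒n≡0 (ind (P fzero)) c) w t

count-witness : ∀ {n} (P : Fin n → Bool) {k} → count P ≡ suc k → Σ (Fin n) (T ∘ P)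
count-witness {suc n} P c with P fzero in e
... | true  = fzero , subst T (sym e) tt
... | false = let (w , t) = count-witness (P ∘ fsuc) c in fsuc w , t

pair : ∀ {n} → Fin n → Fin n → Fin n → Bool
pair p q w = p == w ∨ q == w

count-pair : ∀ {n} {p q : Fin n} → p ≢ q → count (pair p q) ≡ 2
count-pair {p = p} {q} p≢q =
  trans (count-∨ (p ==_) (q ==_) (λ w p=w q=w → p≢q (trans (==⇒≡ p=w) (sym (==⇒≡ q=w)))))
        (cong₂ _+_ (count-single p) (count-single q))

count-remove : ∀ {n} (P R : Fin n → Bool) → (∀ w → T (R w) → T (P w)) →
               count P ≡ count (λ w → P w ∧ not (R w)) + count R
count-remove P R R⊆P =
  trans (count-cong (λ w → split (P w) (R w) (R⊆P w)))
        (count-∨ _ R (λ w → disjoint (P w) (R w)))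
  where
  split : ∀ p r → (T r → T p) → p ≡ (p ∧ not r) ∨ r
  split true  true  _ = refl
  split true  false _ = refl
  split false true  h = ⊥-elim (h tt)
  split false false _ = refl
  disjoint : ∀ p r → T (p ∧ not r) → T r → ⊥
  disjoint true true () _

count-≥2 : ∀ {n} (P : Fin n → Bool) {p q} → p ≢ q → T (P p) → T (P q) → 2 ≤ count P
count-≥2 P {p} {q} p≢q Pp Pq =
  subst (2 ≤_) (sym (count-remove P (pair p q) in-P))
        (subst (λ k → 2 ≤ rest + k) (sym (count-pair p≢q)) (m≤n+m 2 rest))
  where
  rest : ℕ
  rest = count (λ w → P w ∧ not (pair p q w))
  in-P : ∀ w → T (pair p q w) → T (P w)
  in-P w t with T-∨-elim (p == w) t
  ... | inj₁ p=w = subst (T ∘ P) (==⇒≡ p=w) Pp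
  ... | inj₂ q=w = subst (T ∘ P) (==⇒≡ q=w) Pq

count-unique : ∀ {n} (P : Fin n → Bool) → count P ≡ 1 → ∀ {a b} → T (P a) → T (P b) → a ≡ b
count-unique P c {a} {b} Pa Pb with a ≟ᶠ b
... | yes a≡b = a≡b
... | no  a≢b = ⊥-elim (<-irrefl refl (≤-trans (count-≥2 P a≢b Pa Pb) (≤-reflexive c)))

-- Complements.  For every w, v is exactly one of: adjacent to w in the
-- complement, adjacent to w in G, or equal to w; hence the complement of an
-- r-regular simple graph on n vertices is (n - r - 1)-regular.

complement-adj : ∀ {n} (G : Graph n) {u v} → T (complement G u v) → ¬ T (G u v) × u ≢ v
complement-adj G t with Equivalence.to T-∧ t
... | ¬G , ¬eq = not-T ¬G , λ u≡v → not-T ¬eq (≡⇒== u≡v)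

adj-complement : ∀ {n} (G : Graph n) {u v} → ¬ T (G u v) → u ≢ v → T (complement G u v)
adj-complement G ¬G u≢v = Equivalence.from T-∧ (T-not ¬G , T-not (u≢v ∘ ==⇒≡))

complement-simple : ∀ {n} (G : Graph n) → (∀ u v → G u v ≡ G v u) → IsSimple (complement G)
complement-simple G G-sym =
  (λ u v → cong₂ (λ x y → not x ∧ not y) (G-sym u v) (==-sym u v)) ,
  (λ u → trans (cong (λ b → not (G u u) ∧ not b) (==-refl u)) (∧-zeroʳ (not (G u u))))

complement-degree : ∀ {n} (G : Graph n) v → G v v ≡ false →
                    degree (complement G) v + degree G v + 1 ≡ n
complement-degree {n} G v loopless = begin
  degree (complement G) v + degree G v + 1
    ≡⟨ cong₂ (λ x y → x + y + 1) (degree≡count (complement G) v) (degree≡count G v) ⟩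
  count (complement G v) + count (G v) + 1
    ≡⟨ cong (count (complement G v) + count (G v) +_) (sym (count-single v)) ⟩
  count (complement G v) + count (G v) + count (v ==_)
    ≡⟨ cong (_+ count (v ==_)) (sym (count-∨ (complement G v) (G v) (λ w → proj₁ ∘ complement-adj G))) ⟩
  count (λ w → complement G v w ∨ G v w) + count (v ==_)
    ≡⟨ sym (count-∨ _ (v ==_) not-self) ⟩
  count (λ w → (complement G v w ∨ G v w) ∨ v == w)
    ≡⟨ count-all _ exhaustive ⟩
  n ∎
  where
  open ≡-Reasoning
  not-self : ∀ w → T (complement G v w ∨ G v w) → T (v == w) → ⊥
  not-self w t v=w with T-∨-elim (complement G v w) t | ==⇒≡ {u = v} v=w
  ... | inj₁ c | refl = proj₂ (complement-adj G c) refl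
  ... | inj₂ g | refl = subst T loopless g
  exhaustive : ∀ w → T ((complement G v w ∨ G v w) ∨ v == w)
  exhaustive w with T? (G v w) | T? (v == w)
  ... | _      | yes e = T-∨-introʳ (complement G v w ∨ G v w) e
  ... | yes g  | no _  = T-∨-introˡ (v == w) (T-∨-introʳ (complement G v w) g)
  ... | no ¬g  | no ¬e = T-∨-introˡ (v == w) (T-∨-introˡ (G v w) (adj-complement G ¬g (¬e ∘ ≡⇒==)))

complement-regular : ∀ {n r} (G : Graph n) → IsSimple G → IsRegular r G →
                     ∀ v → degree (complement G) v + (r + 1) ≡ n
complement-regular {n} {r} G (_ , loopless) regular v =
  trans (sym (+-assoc (degree (complement G) v) r 1))
        (subst (λ d → degree (complement G) v + d + 1 ≡ n) (regular v) (complement-degree G v (loopless v)))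

-- Disjoint unions.  A vertex of G ⊕ H lies on the left (i ↑ˡ n) or on the
-- right (m ↑ʳ j) and edges never cross sides, so the properties we need are
-- inherited from the two summands.

data Side (m n : ℕ) : Fin (m + n) → Set where
  left  : (i : Fin m) → Side m n (i ↑ˡ n)
  right : (j : Fin n) → Side m n (m ↑ʳ j)

side : ∀ m n (u : Fin (m + n)) → Side m n u
side m n u with splitAt m u in eq
... | inj₁ i = subst (Side m n) (splitAt⁻¹-↑ˡ eq) (left i)
... | inj₂ j = subst (Side m n) (splitAt⁻¹-↑ʳ eq) (right j)

left≢right : ∀ {m n} (i : Fin m) (j : Fin n) → i ↑ˡ n ≢ m ↑ʳ j
left≢right {m} {n} i j e =
  <-irrefl (trans (sym (toℕ-↑ˡ i n)) (trans (cong toℕ e) (toℕ-↑ʳ m j)))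
           (<-≤-trans (toℕ<n i) (m≤m+n m (toℕ j)))

∑-↑ : ∀ m n (f : Fin (m + n) → ℕ) → ∑[ k < m + n ] f k ≡ ∑[ i < m ] f (i ↑ˡ n) + ∑[ j < n ] f (m ↑ʳ j)
∑-↑ zero    n f = refl
∑-↑ (suc m) n f = trans (cong (f fzero +_) (∑-↑ m n (f ∘ fsuc))) (sym (+-assoc (f fzero) _ _))

module _ {m n : ℕ} (G : Graph m) (H : Graph n) where

  ⊕-ll : ∀ i j → (G ⊕ H) (i ↑ˡ n) (j ↑ˡ n) ≡ G i j
  ⊕-ll i j rewrite splitAt-↑ˡ m i n | splitAt-↑ˡ m j n = refl

  ⊕-rr : ∀ i j → (G ⊕ H) (m ↑ʳ i) (m ↑ʳ j) ≡ H i j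
  ⊕-rr i j rewrite splitAt-↑ʳ m n i | splitAt-↑ʳ m n j = refl

  ⊕-lr : ∀ i j → (G ⊕ H) (i ↑ˡ n) (m ↑ʳ j) ≡ false
  ⊕-lr i j rewrite splitAt-↑ˡ m i n | splitAt-↑ʳ m n j = refl

  ⊕-rl : ∀ i j → (G ⊕ H) (m ↑ʳ i) (j ↑ˡ n) ≡ false
  ⊕-rl i j rewrite splitAt-↑ʳ m n i | splitAt-↑ˡ m j n = refl

  ⊕-symmetric : (∀ u v → G u v ≡ G v u) → (∀ u v → H u v ≡ H v u) → ∀ u v → (G ⊕ H) u v ≡ (G ⊕ H) v u
  ⊕-symmetric G-sym H-sym u v with side m n u | side m n v
  ... | left i  | left j  = trans (⊕-ll i j) (trans (G-sym i j) (sym (⊕-ll j i)))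
  ... | left i  | right j = trans (⊕-lr i j) (sym (⊕-rl j i))
  ... | right i | left j  = trans (⊕-rl i j) (sym (⊕-lr j i))
  ... | right i | right j = trans (⊕-rr i j) (trans (H-sym i j) (sym (⊕-rr j i)))

  ⊕-loopless : (∀ u → G u u ≡ false) → (∀ u → H u u ≡ false) → ∀ u → (G ⊕ H) u u ≡ false
  ⊕-loopless G-loopless H-loopless u with side m n u
  ... | left i  = trans (⊕-ll i i) (G-loopless i)
  ... | right j = trans (⊕-rr j j) (H-loopless j)

  degree-⊕ˡ : ∀ i → degree (G ⊕ H) (i ↑ˡ n) ≡ degree G i
  degree-⊕ˡ i = begin
    degree (G ⊕ H) (i ↑ˡ n)
      ≡⟨ trans (degree≡count (G ⊕ H) (i ↑ˡ n)) (∑-↑ m n _) ⟩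
    count (λ w → (G ⊕ H) (i ↑ˡ n) (w ↑ˡ n)) + count (λ w → (G ⊕ H) (i ↑ˡ n) (m ↑ʳ w))
      ≡⟨ cong₂ _+_ (count-cong (⊕-ll i)) (count-empty _ (⊕-lr i)) ⟩
    count (G i) + 0
      ≡⟨ trans (+-identityʳ _) (sym (degree≡count G i)) ⟩
    degree G i ∎
    where open ≡-Reasoning

  degree-⊕ʳ : ∀ j → degree (G ⊕ H) (m ↑ʳ j) ≡ degree H j
  degree-⊕ʳ j = begin
    degree (G ⊕ H) (m ↑ʳ j)
      ≡⟨ trans (degree≡count (G ⊕ H) (m ↑ʳ j)) (∑-↑ m n _) ⟩
    count (λ w → (G ⊕ H) (m ↑ʳ j) (w ↑ˡ n)) + count (λ w → (G ⊕ H) (m ↑ʳ j) (m ↑ʳ w))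
      ≡⟨ cong₂ _+_ (count-empty _ (⊕-rl j)) (count-cong (⊕-rr j)) ⟩
    count (H j)
      ≡⟨ sym (degree≡count H j) ⟩
    degree H j ∎
    where open ≡-Reasoning

  ⊕-regular : ∀ {r} → IsRegular r G → IsRegular r H → IsRegular r (G ⊕ H)
  ⊕-regular G-reg H-reg u with side m n u
  ... | left i  = trans (degree-⊕ˡ i) (G-reg i)
  ... | right j = trans (degree-⊕ʳ j) (H-reg j)

-- Cycles.  Adjacency in C_l is decoded from the Boolean formula of Defs into
-- an inductive relation on vertex numbers, in which symmetry, looplessness
-- and "every vertex has exactly two neighbours" are easy case analyses.

cycleℕ : ℕ → ℕ → ℕ → Bool
cycleℕ l a b = (suc a ≡ᵇ b) ∨ (suc b ≡ᵇ a) ∨ ((suc (a + b) ≡ᵇ l) ∧ ((a ≡ᵇ 0) ∨ (b ≡ᵇ 0)))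

data CycleAdj (l : ℕ) : ℕ → ℕ → Set where
  next   : ∀ a → CycleAdj l a (suc a)
  prev   : ∀ a → CycleAdj l (suc a) a
  close  : ∀ {b} → suc b ≡ l → CycleAdj l 0 b
  close⁻ : ∀ {a} → suc a ≡ l → CycleAdj l a 0

decode : ∀ l a b → T (cycleℕ l a b) → CycleAdj l a b
decode l a b t with T-∨-elim (suc a ≡ᵇ b) t
... | inj₁ e with ≡ᵇ⇒≡ (suc a) b e
...   | refl = next a
decode l a b t | inj₂ t′ with T-∨-elim (suc b ≡ᵇ a) t′
... | inj₁ e with ≡ᵇ⇒≡ (suc b) a e
...   | refl = prev b
decode l a b t | inj₂ t′ | inj₂ t″ with Equivalence.to (T-∧ {suc (a + b) ≡ᵇ l}) t″
... | e , ends with T-∨-elim (a ≡ᵇ 0) ends | ≡ᵇ⇒≡ (suc (a + b)) l e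
...   | inj₁ a=0 | e′ with ≡ᵇ⇒≡ a 0 a=0
...     | refl = close e′
decode l a b t | inj₂ t′ | inj₂ t″ | e , ends | inj₂ b=0 | e′ with ≡ᵇ⇒≡ b 0 b=0
...     | refl = close⁻ (trans (cong suc (sym (+-identityʳ a))) e′)

encode : ∀ {l a b} → CycleAdj l a b → T (cycleℕ l a b)
encode (next a) = T-∨-introˡ _ (≡⇒≡ᵇ (suc a) (suc a) refl)
encode (prev a) = T-∨-introʳ (suc (suc a) ≡ᵇ a) (T-∨-introˡ _ (≡⇒≡ᵇ (suc a) (suc a) refl))
encode {l} {a = 0} {b} (close e) =
  T-∨-introʳ (1 ≡ᵇ b) (T-∨-introʳ (suc b ≡ᵇ 0)
    (Equivalence.from (T-∧ {suc b ≡ᵇ l}) (≡⇒≡ᵇ (suc b) l e , T-∨-introˡ (b ≡ᵇ 0) tt)))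
encode {l} {a} {b = 0} (close⁻ e) =
  T-∨-introʳ (suc a ≡ᵇ 0) (T-∨-introʳ (1 ≡ᵇ a)
    (Equivalence.from (T-∧ {suc (a + 0) ≡ᵇ l})
      (≡⇒≡ᵇ (suc (a + 0)) l (trans (cong suc (+-identityʳ a)) e) , T-∨-introʳ (a ≡ᵇ 0) tt)))

CycleAdj-sym : ∀ {l a b} → CycleAdj l a b → CycleAdj l b a
CycleAdj-sym (next a)   = prev a
CycleAdj-sym (prev a)   = next a
CycleAdj-sym (close e)  = close⁻ e
CycleAdj-sym (close⁻ e) = close e

cycle-symmetric : ∀ l (u v : Fin l) → cycle l u v ≡ cycle l v u
cycle-symmetric l u v =
  T-ext (encode ∘ CycleAdj-sym ∘ decode l (toℕ u) (toℕ v))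
        (encode ∘ CycleAdj-sym ∘ decode l (toℕ v) (toℕ u))

cycle-loopless : ∀ l → 3 ≤ l → ∀ u → cycle l u u ≡ false
cycle-loopless l 3≤l u = T-ext (no-loop ∘ decode l (toℕ u) (toℕ u)) ⊥-elim
  where
  3≰1 : 3 ≤ 1 → ⊥
  3≰1 (s≤s ())
  no-loop : ∀ {a} → CycleAdj l a a → ⊥
  no-loop (close e)  = 3≰1 (subst (3 ≤_) (sym e) 3≤l)
  no-loop (close⁻ e) = 3≰1 (subst (3 ≤_) (sym e) 3≤l)

record Neighbours (l a : ℕ) : Set where
  field
    p q   : ℕ
    p<l   : p < l
    q<l   : q < l
    p≢q   : p ≢ q
    adj-p : CycleAdj l a p
    adj-q : CycleAdj l a q
    only  : ∀ x → x < l → CycleAdj l a x → x ≡ p ⊎ x ≡ q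

neighbours : ∀ l a → 3 ≤ l → a < l → Neighbours l a
neighbours (suc (suc (suc k))) zero _ _ = record
  { p = 1 ; q = suc (suc k) ; p<l = s≤s (s≤s z≤n) ; q<l = ≤-refl ; p≢q = λ ()
  ; adj-p = next 0 ; adj-q = close refl ; only = only }
  where
  only : ∀ x → x < suc (suc (suc k)) → CycleAdj (suc (suc (suc k))) 0 x → x ≡ 1 ⊎ x ≡ suc (suc k)
  only _ _ (next 0)   = inj₁ refl
  only _ _ (close e)  = inj₂ (suc-injective e)
  only _ _ (close⁻ ())
neighbours (suc zero)       zero (s≤s ()) _
neighbours (suc (suc zero)) zero (s≤s (s≤s ())) _
neighbours l (suc a) 3≤l a<l with m≤n⇒m<n∨m≡n a<l
... | inj₁ 2+a<l = record
  { p = a ; q = suc (suc a) ; p<l = <-trans (n<1+n a) a<l ; q<l = 2+a<l ; p≢q = <⇒≢ (n≤1+n (suc a))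
  ; adj-p = prev a ; adj-q = next (suc a) ; only = only }
  where
  only : ∀ x → x < l → CycleAdj l (suc a) x → x ≡ a ⊎ x ≡ suc (suc a)
  only _ _ (next _)   = inj₂ refl
  only _ _ (prev _)   = inj₁ refl
  only _ _ (close⁻ e) = ⊥-elim (<-irrefl e 2+a<l)
... | inj₂ refl = record
  { p = a ; q = 0 ; p<l = <-trans (n<1+n a) a<l ; q<l = s≤s z≤n ; p≢q = λ { refl → a≢0 refl }
  ; adj-p = prev a ; adj-q = close⁻ refl ; only = only }
  where
  a≢0 : a ≢ 0
  a≢0 e with subst (λ x → 3 ≤ suc (suc x)) e 3≤l
  ... | s≤s (s≤s ())
  only : ∀ x → x < suc (suc a) → CycleAdj (suc (suc a)) (suc a) x → x ≡ a ⊎ x ≡ 0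
  only _ x<l (next _)   = ⊥-elim (<-irrefl refl x<l)
  only _ _   (prev _)   = inj₁ refl
  only _ _   (close⁻ _) = inj₂ refl

cycle-regular : ∀ l → 3 ≤ l → IsRegular 2 (cycle l)
cycle-regular l 3≤l j =
  trans (degree≡count (cycle l) j) (trans (count-cong same) (count-pair p′≢q′))
  where
  open Neighbours (neighbours l (toℕ j) 3≤l (toℕ<n j))
  p′ q′ : Fin l
  p′ = fromℕ< p<l
  q′ = fromℕ< q<l
  p′≢q′ : p′ ≢ q′
  p′≢q′ e = p≢q (trans (sym (toℕ-fromℕ< p<l)) (trans (cong toℕ e) (toℕ-fromℕ< q<l)))
  vertex : ∀ {x} (x<l : x < l) {w} → toℕ w ≡ x → T (fromℕ< x<l == w)
  vertex x<l e = ≡⇒== (toℕ-injective (trans (toℕ-fromℕ< x<l) (sym e)))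
  number : ∀ {x} (x<l : x < l) {w} → T (fromℕ< x<l == w) → x ≡ toℕ w
  number x<l e = trans (sym (toℕ-fromℕ< x<l)) (cong toℕ (==⇒≡ e))
  same : ∀ w → cycle l j w ≡ pair p′ q′ w
  same w = T-ext to from
    where
    to : T (cycle l j w) → T (pair p′ q′ w)
    to t with only (toℕ w) (toℕ<n w) (decode l (toℕ j) (toℕ w) t)
    ... | inj₁ e = T-∨-introˡ (q′ == w) (vertex p<l e)
    ... | inj₂ e = T-∨-introʳ (p′ == w) (vertex q<l e)
    from : T (pair p′ q′ w) → T (cycle l j w)
    from t with T-∨-elim (p′ == w) t
    ... | inj₁ e = encode (subst (CycleAdj l (toℕ j)) (number p<l e) adj-p)
    ... | inj₂ e = encode (subst (CycleAdj l (toℕ j)) (number q<l e) adj-q)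

cycles-symmetric : ∀ ls (u v : Fin (sum ls)) → cycles ls u v ≡ cycles ls v u
cycles-symmetric []       ()
cycles-symmetric (l ∷ ls) = ⊕-symmetric (cycle l) (cycles ls) (cycle-symmetric l) (cycles-symmetric ls)

cycles-loopless : ∀ {ls} → All (3 ≤_) ls → ∀ u → cycles ls u u ≡ false
cycles-loopless {[]}     []         ()
cycles-loopless {l ∷ ls} (3≤l ∷ 3≤ls) =
  ⊕-loopless (cycle l) (cycles ls) (cycle-loopless l 3≤l) (cycles-loopless 3≤ls)

cycles-regular : ∀ {ls} → All (3 ≤_) ls → IsRegular 2 (cycles ls)
cycles-regular {[]}     []         ()
cycles-regular {l ∷ ls} (3≤l ∷ 3≤ls) = ⊕-regular (cycle l) (cycles ls) (cycle-regular l 3≤l) (cycles-regular 3≤ls)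

-- Clique covers.  A proper colouring of complement G is the same thing as a
-- colouring of G whose colour classes are cliques of G.  Upper bounds on the
-- number of colours come from explicit clique covers, lower bounds from
-- "rainbow" vertex sets that every clique cover must colour injectively.

IsCliqueCover : ∀ {n k} → Graph n → (Fin n → Fin k) → Set
IsCliqueCover {n} G c = ∀ (u v : Fin n) → c u ≡ c v → u ≢ v → T (G u v)

cover⇒colouring : ∀ {n k} (G : Graph n) {c : Fin n → Fin k} → IsCliqueCover G c →
                  ∀ u v → T (complement G u v) → c u ≢ c v
cover⇒colouring G cover u v t cu≡cv =
  proj₁ (complement-adj G t) (cover u v cu≡cv (proj₂ (complement-adj G t)))

colouring⇒cover : ∀ {n k} (G : Graph n) {c : Fin n → Fin k} →
                  (∀ u v → T (complement G u v) → c u ≢ c v) → IsCliqueCover G c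
colouring⇒cover G proper u v cu≡cv u≢v with T? (G u v)
... | yes adjacent = adjacent
... | no ¬adjacent = ⊥-elim (proper u v (adj-complement G ¬adjacent u≢v) cu≡cv)

Rainbow : ∀ {n k} → (Fin n → Fin k) → ℕ → Set
Rainbow {n} c K = Σ (Fin K → Fin n) λ g → ∀ x y → c (g x) ≡ c (g y) → x ≡ y

rainbow-≤ : ∀ {n k} {c : Fin n → Fin k} {K} → Rainbow c K → K ≤ k
rainbow-≤ (g , injective) = injective⇒≤ (λ {x} {y} → injective x y)

ForcesColours : ∀ {n} → Graph n → ℕ → Set
ForcesColours {n} G K = ∀ {k} (c : Fin n → Fin k) → IsCliqueCover G c → Rainbow c K

rainbow : ∀ {n k K} (G : Graph n) {c : Fin n → Fin k} → IsCliqueCover G c →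
          (g : Fin K → Fin n) → (∀ x y → g x ≡ g y → x ≡ y) →
          (∀ x y → x ≢ y → T (G (g x) (g y)) → c (g x) ≢ c (g y)) → Rainbow c K
rainbow G cover g g-injective separated = g , injective
  where
  injective : ∀ x y → _ → x ≡ y
  injective x y same with x ≟ᶠ y
  ... | yes x≡y = x≡y
  ... | no  x≢y = ⊥-elim (separated x y x≢y (cover (g x) (g y) same (x≢y ∘ g-injective x y)) same)

module _ {m n : ℕ} (G : Graph m) (H : Graph n) where

  ⊕-cover : ∀ {k₁ k₂} {c₁ : Fin m → Fin k₁} {c₂ : Fin n → Fin k₂} →
            IsCliqueCover G c₁ → IsCliqueCover H c₂ →
            Σ (Fin (m + n) → Fin (k₁ + k₂)) (IsCliqueCover (G ⊕ H))
  ⊕-cover {k₁} {k₂} {c₁} {c₂} cover₁ cover₂ = c , cover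
    where
    c : Fin (m + n) → Fin (k₁ + k₂)
    c u = [ (λ i → c₁ i ↑ˡ k₂) , (λ j → k₁ ↑ʳ c₂ j) ] (splitAt m u)
    c-left : ∀ i → c (i ↑ˡ n) ≡ c₁ i ↑ˡ k₂
    c-left i rewrite splitAt-↑ˡ m i n = refl
    c-right : ∀ j → c (m ↑ʳ j) ≡ k₁ ↑ʳ c₂ j
    c-right j rewrite splitAt-↑ʳ m n j = refl
    cover : IsCliqueCover (G ⊕ H) c
    cover u v same u≢v with side m n u | side m n v
    ... | left i  | left j  = subst T (sym (⊕-ll G H i j))
      (cover₁ i j (↑ˡ-injective k₂ _ _ (trans (sym (c-left i)) (trans same (c-left j)))) (u≢v ∘ cong (_↑ˡ n)))
    ... | left i  | right j = ⊥-elim (left≢right (c₁ i) (c₂ j) (trans (sym (c-left i)) (trans same (c-right j))))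
    ... | right i | left j  = ⊥-elim (left≢right (c₁ j) (c₂ i) (trans (sym (c-left j)) (trans (sym same) (c-right i))))
    ... | right i | right j = subst T (sym (⊕-rr G H i j))
      (cover₂ i j (↑ʳ-injective k₁ _ _ (trans (sym (c-right i)) (trans same (c-right j)))) (u≢v ∘ cong (m ↑ʳ_)))

  ⊕-forces : ∀ {K₁ K₂} → ForcesColours G K₁ → ForcesColours H K₂ → ForcesColours (G ⊕ H) (K₁ + K₂)
  ⊕-forces {K₁} {K₂} forces₁ forces₂ c cover = g , injective
    where
    cover₁ : IsCliqueCover G (c ∘ (_↑ˡ n))
    cover₁ i j same i≢j = subst T (⊕-ll G H i j) (cover _ _ same (i≢j ∘ ↑ˡ-injective n i j))
    cover₂ : IsCliqueCover H (c ∘ (m ↑ʳ_))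
    cover₂ i j same i≢j = subst T (⊕-rr G H i j) (cover _ _ same (i≢j ∘ ↑ʳ-injective m i j))
    rainbow₁ : Rainbow (c ∘ (_↑ˡ n)) K₁
    rainbow₁ = forces₁ (c ∘ (_↑ˡ n)) cover₁
    rainbow₂ : Rainbow (c ∘ (m ↑ʳ_)) K₂
    rainbow₂ = forces₂ (c ∘ (m ↑ʳ_)) cover₂
    g₁ : Fin K₁ → Fin m
    g₁ = proj₁ rainbow₁
    g₂ : Fin K₂ → Fin n
    g₂ = proj₁ rainbow₂
    g : Fin (K₁ + K₂) → Fin (m + n)
    g x = [ (λ a → g₁ a ↑ˡ n) , (λ b → m ↑ʳ g₂ b) ] (splitAt K₁ x)
    g-left : ∀ a → g (a ↑ˡ K₂) ≡ g₁ a ↑ˡ n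
    g-left a rewrite splitAt-↑ˡ K₁ a K₂ = refl
    g-right : ∀ b → g (K₁ ↑ʳ b) ≡ m ↑ʳ g₂ b
    g-right b rewrite splitAt-↑ʳ K₁ K₂ b = refl
    -- a colour class is a clique, so it cannot meet both sides
    sides-differ : ∀ a b → c (g₁ a ↑ˡ n) ≢ c (m ↑ʳ g₂ b)
    sides-differ a b same =
      subst T (⊕-lr G H (g₁ a) (g₂ b)) (cover _ _ same (left≢right (g₁ a) (g₂ b)))
    injective : ∀ x y → c (g x) ≡ c (g y) → x ≡ y
    injective x y same with side K₁ K₂ x | side K₁ K₂ y
    ... | left a  | left b  =
      cong (_↑ˡ K₂) (proj₂ rainbow₁ a b (trans (cong c (sym (g-left a))) (trans same (cong c (g-left b)))))
    ... | left a  | right b =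
      ⊥-elim (sides-differ a b (trans (cong c (sym (g-left a))) (trans same (cong c (g-right b)))))
    ... | right a | left b  =
      ⊥-elim (sides-differ b a (trans (cong c (sym (g-left b))) (trans (sym same) (cong c (g-right a)))))
    ... | right a | right b =
      cong (K₁ ↑ʳ_) (proj₂ rainbow₂ a b (trans (cong c (sym (g-right a))) (trans same (cong c (g-right b)))))

-- Clique covers of a single cycle.  C_3 is itself a clique; a longer cycle C_l
-- is covered by the edges {2i, 2i+1} (plus the single vertex l - 1 when l is
-- odd), using ⌈l/2⌉ cliques.

κ : ℕ → ℕ
κ 3 = 1
κ l = ⌈ l /2⌉

triangle : ∀ (u v : Fin 3) → u ≢ v → T (cycle 3 u v)
triangle fzero               fzero               u≢v = ⊥-elim (u≢v refl)
triangle fzero               (fsuc fzero)        _   = tt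
triangle fzero               (fsuc (fsuc fzero)) _   = tt
triangle (fsuc fzero)        fzero               _   = tt
triangle (fsuc fzero)        (fsuc fzero)        u≢v = ⊥-elim (u≢v refl)
triangle (fsuc fzero)        (fsuc (fsuc fzero)) _   = tt
triangle (fsuc (fsuc fzero)) fzero               _   = tt
triangle (fsuc (fsuc fzero)) (fsuc fzero)        _   = tt
triangle (fsuc (fsuc fzero)) (fsuc (fsuc fzero)) u≢v = ⊥-elim (u≢v refl)

same-half : ∀ a b → ⌊ a /2⌋ ≡ ⌊ b /2⌋ → a ≡ b ⊎ suc a ≡ b ⊎ suc b ≡ a
same-half zero          zero          _ = inj₁ refl
same-half zero          (suc zero)    _ = inj₂ (inj₁ refl)
same-half (suc zero)    zero          _ = inj₂ (inj₂ refl)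
same-half (suc zero)    (suc zero)    _ = inj₁ refl
same-half (suc (suc a)) (suc (suc b)) e with same-half a b (suc-injective e)
... | inj₁ a≡b          = inj₁ (cong (suc ∘ suc) a≡b)
... | inj₂ (inj₁ a+1≡b) = inj₂ (inj₁ (cong (suc ∘ suc) a+1≡b))
... | inj₂ (inj₂ b+1≡a) = inj₂ (inj₂ (cong (suc ∘ suc) b+1≡a))

cycle-cover : ∀ l → 3 ≤ l → Σ (Fin l → Fin (κ l)) (IsCliqueCover (cycle l))
cycle-cover 1 (s≤s ())
cycle-cover 2 (s≤s (s≤s ()))
cycle-cover 3 _ = (λ _ → fzero) , λ u v _ → triangle u v
cycle-cover l@(suc (suc (suc (suc _)))) _ = half , cover
  where
  half< : ∀ {a} → a < l → ⌊ a /2⌋ < ⌈ l /2⌉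
  half< a<l = ⌈n/2⌉-mono a<l
  half : Fin l → Fin ⌈ l /2⌉
  half j = fromℕ< (half< (toℕ<n j))
  cover : IsCliqueCover (cycle l) half
  cover u v same u≢v
    with same-half (toℕ u) (toℕ v)
           (trans (sym (toℕ-fromℕ< (half< (toℕ<n u)))) (trans (cong toℕ same) (toℕ-fromℕ< (half< (toℕ<n v)))))
  ... | inj₁ e          = ⊥-elim (u≢v (toℕ-injective e))
  ... | inj₂ (inj₁ u+1≡v) = encode (subst (CycleAdj l (toℕ u)) u+1≡v (next (toℕ u)))
  ... | inj₂ (inj₂ v+1≡u) = encode (subst (λ x → CycleAdj l x (toℕ v)) v+1≡u (prev (toℕ v)))

-- Rainbow sets of a single cycle.  In C_{2L} the even vertices are pairwise
-- non-adjacent, so they form a rainbow set of size L.  In C_{2L+1} (L ≥ 2) the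
-- even vertices 0, 2, …, 2L are non-adjacent except for the closing edge
-- {0, 2L}: if its ends get different colours they are rainbow; otherwise 0
-- and 1 get different colours and {0, 1, 3, …, 2L-1} is rainbow.

-- double n = 2n, defined by recursion so that parities are visible to pattern matching.
double : ℕ → ℕ
double zero    = 0
double (suc n) = suc (suc (double n))

double-injective : ∀ a b → double a ≡ double b → a ≡ b
double-injective zero    zero    _ = refl
double-injective (suc a) (suc b) e = cong suc (double-injective a b (suc-injective (suc-injective e)))

odd≢even : ∀ a b → suc (double a) ≢ double b
odd≢even zero    (suc b) ()
odd≢even (suc a) (suc b) e = odd≢even a b (suc-injective (suc-injective e))

double≡+ : ∀ n → double n ≡ n + n
double≡+ zero    = refl
double≡+ (suc n) = cong suc (trans (cong suc (double≡+ n)) (sym (+-suc n n)))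

double-+ : ∀ a b → double (a + b) ≡ double a + double b
double-+ zero    b = refl
double-+ (suc a) b = cong (suc ∘ suc) (double-+ a b)

double-mono : ∀ {a b} → a ≤ b → double a ≤ double b
double-mono z≤n       = z≤n
double-mono (s≤s a≤b) = s≤s (s≤s (double-mono a≤b))

double≡0 : ∀ {a} → 0 ≡ double a → a ≡ 0
double≡0 {zero} _ = refl

evens : ∀ {L} → Fin (suc L) → Fin (suc (double L))
evens          fzero    = fzero
evens {suc L} (fsuc x) = fsuc (fsuc (evens x))

odds : ∀ {L} → Fin L → Fin (suc (double L))
odds {suc L} fzero    = fsuc fzero
odds {suc L} (fsuc x) = fsuc (fsuc (odds x))

toℕ-evens : ∀ {L} (x : Fin (suc L)) → toℕ (evens x) ≡ double (toℕ x)
toℕ-evens          fzero    = refl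
toℕ-evens {suc L} (fsuc x) = cong (suc ∘ suc) (toℕ-evens x)

toℕ-odds : ∀ {L} (x : Fin L) → toℕ (odds x) ≡ suc (double (toℕ x))
toℕ-odds {suc L} fzero    = refl
toℕ-odds {suc L} (fsuc x) = cong (suc ∘ suc) (toℕ-odds x)

evens-injective : ∀ {L} (x y : Fin (suc L)) → evens x ≡ evens y → x ≡ y
evens-injective x y e = toℕ-injective (double-injective _ _
  (trans (sym (toℕ-evens x)) (trans (cong toℕ e) (toℕ-evens y))))

odds-injective : ∀ {L} (x y : Fin L) → odds x ≡ odds y → x ≡ y
odds-injective x y e = toℕ-injective (double-injective _ _ (suc-injective
  (trans (sym (toℕ-odds x)) (trans (cong toℕ e) (toℕ-odds y)))))

even-adj : ∀ {l a b} → CycleAdj l (double a) (double b) →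
           (a ≡ 0 × suc (double b) ≡ l) ⊎ (suc (double a) ≡ l × b ≡ 0)
even-adj adj = go adj refl refl
  where
  go : ∀ {l x y a b} → CycleAdj l x y → x ≡ double a → y ≡ double b →
       (a ≡ 0 × suc (double b) ≡ l) ⊎ (suc (double a) ≡ l × b ≡ 0)
  go (next x)   refl ey = ⊥-elim (odd≢even _ _ ey)
  go (prev y)   ex refl = ⊥-elim (odd≢even _ _ ex)
  go (close e)  ex refl = inj₁ (double≡0 ex , e)
  go (close⁻ e) refl ey = inj₂ (e , double≡0 ey)

odd-nonadjacent : ∀ {l a b} → CycleAdj l (suc (double a)) (suc (double b)) → ⊥
odd-nonadjacent adj = go adj refl refl
  where
  go : ∀ {l x y a b} → CycleAdj l x y → x ≡ suc (double a) → y ≡ suc (double b) → ⊥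
  go (next x) refl ey = odd≢even _ _ (suc-injective ey)
  go (prev y) ex refl = odd≢even _ _ (suc-injective ex)
  go (close e)  () _
  go (close⁻ e) _ ()

zero-odd-adj : ∀ {l b} → CycleAdj l 0 (suc (double b)) → b ≡ 0 ⊎ suc (suc (double b)) ≡ l
zero-odd-adj adj = go adj refl
  where
  go : ∀ {l y b} → CycleAdj l 0 y → y ≡ suc (double b) → b ≡ 0 ⊎ suc (suc (double b)) ≡ l
  go (next 0)  e    = inj₁ (double≡0 (suc-injective e))
  go (close e) refl = inj₂ e
  go (close⁻ e) ()

even-cycle-forces : ∀ L → ForcesColours (cycle (double (suc L))) (suc L)
even-cycle-forces L c cover = rainbow (cycle l) cover vertex vertex-injective separated
  where
  l = double (suc L)
  vertex : Fin (suc L) → Fin l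
  vertex = inject₁ ∘ evens
  toℕ-vertex : ∀ x → toℕ (vertex x) ≡ double (toℕ x)
  toℕ-vertex x = trans (toℕ-inject₁ (evens x)) (toℕ-evens x)
  vertex-injective : ∀ x y → vertex x ≡ vertex y → x ≡ y
  vertex-injective x y = evens-injective x y ∘ inject₁-injective
  separated : ∀ x y → x ≢ y → T (cycle l (vertex x) (vertex y)) → c (vertex x) ≢ c (vertex y)
  separated x y _ adj
    with even-adj (subst₂ (CycleAdj l) (toℕ-vertex x) (toℕ-vertex y) (decode l _ _ adj))
  ... | inj₁ (_ , e) = ⊥-elim (odd≢even _ (suc L) e)
  ... | inj₂ (e , _) = ⊥-elim (odd≢even _ (suc L) e)

evens-rainbow : ∀ L {k} {c : Fin (suc (double L)) → Fin k} → IsCliqueCover (cycle (suc (double L))) c →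
                c fzero ≢ c (evens (fromℕ L)) → Rainbow c (suc L)
evens-rainbow L {c = c} cover ends-differ = rainbow (cycle l) cover evens evens-injective separated
  where
  l = suc (double L)
  first : ∀ {x : Fin (suc L)} → toℕ x ≡ 0 → x ≡ fzero
  first {fzero} _ = refl
  last : ∀ {x : Fin (suc L)} → suc (double (toℕ x)) ≡ l → x ≡ fromℕ L
  last e = toℕ-injective (trans (double-injective _ _ (suc-injective e)) (sym (toℕ-fromℕ L)))
  separated : ∀ x y → x ≢ y → T (cycle l (evens x) (evens y)) → c (evens x) ≢ c (evens y)
  separated x y _ adj
    with even-adj (subst₂ (CycleAdj l) (toℕ-evens x) (toℕ-evens y) (decode l _ _ adj))
  ... | inj₁ (x=0 , y-last) rewrite first x=0 | last y-last = ends-differ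
  ... | inj₂ (x-last , y=0) rewrite last x-last | first y=0 = ends-differ ∘ sym

zero-odds-rainbow : ∀ L {k} {c : Fin (suc (double (suc L))) → Fin k} →
                    IsCliqueCover (cycle (suc (double (suc L)))) c → c fzero ≢ c (fsuc fzero) →
                    Rainbow c (suc (suc L))
zero-odds-rainbow L {c = c} cover zero-one-differ = rainbow (cycle l) cover vertex vertex-injective separated
  where
  l = suc (double (suc L))
  vertex : Fin (suc (suc L)) → Fin l
  vertex fzero    = fzero
  vertex (fsuc x) = odds x
  vertex-injective : ∀ x y → vertex x ≡ vertex y → x ≡ y
  vertex-injective fzero    fzero    _ = refl
  vertex-injective fzero    (fsuc y) e = ⊥-elim (0≢1+n (trans (cong toℕ e) (toℕ-odds y)))
  vertex-injective (fsuc x) fzero    e = ⊥-elim (0≢1+n (trans (cong toℕ (sym e)) (toℕ-odds x)))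
  vertex-injective (fsuc x) (fsuc y) e = cong fsuc (odds-injective x y e)
  zero-odd : ∀ y → CycleAdj l 0 (toℕ (odds y)) → y ≡ fzero
  zero-odd y adj with zero-odd-adj (subst (CycleAdj l 0) (toℕ-odds y) adj)
  ... | inj₁ y=0 = toℕ-injective y=0
  ... | inj₂ e   = ⊥-elim (odd≢even _ (suc L) (suc-injective e))
  separated : ∀ x y → x ≢ y → T (cycle l (vertex x) (vertex y)) → c (vertex x) ≢ c (vertex y)
  separated fzero    fzero    x≢y _ = ⊥-elim (x≢y refl)
  separated fzero    (fsuc y) _ adj rewrite zero-odd y (decode l _ _ adj) = zero-one-differ
  separated (fsuc x) fzero    _ adj rewrite zero-odd x (CycleAdj-sym (decode l _ _ adj)) = zero-one-differ ∘ sym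
  separated (fsuc x) (fsuc y) _ adj = ⊥-elim (odd-nonadjacent
    (subst₂ (CycleAdj l) (toℕ-odds x) (toℕ-odds y) (decode l _ _ adj)))

-- Odd cycles C_{2L+1}, L ≥ 2: if 0 and 2L share a colour, then 1 does not
-- (1 and 2L are distinct and non-adjacent), so one of the two sets applies.
odd-cycle-forces : ∀ L → 2 ≤ L → ForcesColours (cycle (suc (double L))) (suc L)
odd-cycle-forces 1 (s≤s ())
odd-cycle-forces L@(suc (suc L′)) _ c cover with c fzero ≟ᶠ c (evens (fromℕ L))
... | no  ends-differ = evens-rainbow L cover ends-differ
... | yes ends-agree  = zero-odds-rainbow (suc L′) cover zero-one-differ
  where
  l = suc (double L)
  one-last : ¬ CycleAdj l 1 (toℕ (evens (fromℕ L)))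
  one-last ()
  zero-one-differ : c fzero ≢ c (fsuc fzero)
  zero-one-differ same = one-last (decode l _ _
    (cover (fsuc fzero) (evens (fromℕ L)) (trans (sym same) ends-agree) (λ ())))

⌈double/2⌉ : ∀ L → ⌈ double L /2⌉ ≡ L
⌈double/2⌉ zero    = refl
⌈double/2⌉ (suc L) = cong suc (⌈double/2⌉ L)

⌈odd/2⌉ : ∀ L → ⌈ suc (double L) /2⌉ ≡ suc L
⌈odd/2⌉ zero    = refl
⌈odd/2⌉ (suc L) = cong suc (⌈odd/2⌉ L)

data Parity : ℕ → Set where
  even : ∀ L → Parity (double L)
  odd  : ∀ L → Parity (suc (double L))

parity : ∀ n → Parity n
parity zero          = even 0
parity (suc zero)    = odd 0
parity (suc (suc n)) with parity n
... | even L = even (suc L)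
... | odd  L = odd (suc L)

long-cycle-forces : ∀ l → 4 ≤ l → ForcesColours (cycle l) ⌈ l /2⌉
long-cycle-forces l 4≤l with parity l
... | even zero    = λ _ _ → (λ ()) , λ ()
... | even (suc L) = subst (ForcesColours (cycle (double (suc L)))) (sym (⌈double/2⌉ (suc L))) (even-cycle-forces L)
... | odd L        = subst (ForcesColours (cycle (suc (double L)))) (sym (⌈odd/2⌉ L)) (odd-cycle-forces L (half≥2 L 4≤l))
  where
  half≥2 : ∀ L → 4 ≤ suc (double L) → 2 ≤ L
  half≥2 (suc (suc L)) _ = s≤s (s≤s z≤n)
  half≥2 zero       (s≤s ())
  half≥2 (suc zero) (s≤s (s≤s (s≤s ())))

cycle-forces : ∀ l → 3 ≤ l → ForcesColours (cycle l) (κ l)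
cycle-forces 1 (s≤s ())
cycle-forces 2 (s≤s (s≤s ()))
cycle-forces 3 _ _ _ = (λ _ → fzero) , λ { fzero fzero _ → refl }
cycle-forces l@(suc (suc (suc (suc _)))) _ = long-cycle-forces l (s≤s (s≤s (s≤s (s≤s z≤n))))

complement-chromatic : ∀ {n K} (G : Graph n) {c : Fin n → Fin K} → IsCliqueCover G c → ForcesColours G K →
                       ChromaticNumber K (complement G)
complement-chromatic G {c} cover forces =
  (c , cover⇒colouring G cover) ,
  λ k (c′ , proper) → rainbow-≤ {c = c′} (forces c′ (colouring⇒cover G proper))

coverNumber : List ℕ → ℕ
coverNumber ls = sum (map κ ls)

cycles-cover : ∀ {ls} → All (3 ≤_) ls → Σ (Fin (sum ls) → Fin (coverNumber ls)) (IsCliqueCover (cycles ls))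
cycles-cover {[]}     []           = (λ ()) , λ ()
cycles-cover {l ∷ ls} (3≤l ∷ 3≤ls) =
  ⊕-cover (cycle l) (cycles ls) (proj₂ (cycle-cover l 3≤l)) (proj₂ (cycles-cover 3≤ls))

cycles-forces : ∀ {ls} → All (3 ≤_) ls → ForcesColours (cycles ls) (coverNumber ls)
cycles-forces {[]}     []           _ _ = (λ ()) , λ ()
cycles-forces {l ∷ ls} (3≤l ∷ 3≤ls)     = ⊕-forces (cycle l) (cycles ls) (cycle-forces l 3≤l) (cycles-forces 3≤ls)

-- Pairings.  A fixed-point-free involution σ of Fin m (the partner map of a
-- perfect matching) splits Fin m into m/2 pairs {v, σ v}.  The pairs inside
-- a σ-closed set S are numbered by induction on the size of S, removing one
-- pair at a time.
module Pairing {m : ℕ} (σ : Fin m → Fin m) (no-fixed-point : ∀ v → σ v ≢ v)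
               (involutive : ∀ v → σ (σ v) ≡ v) where

  record Numbering (S : Fin m → Bool) : Set where
    field
      pairs   : ℕ
      size    : double pairs ≡ count S
      number  : Fin m → ℕ
      bounded : ∀ v → T (S v) → number v < pairs
      classes : ∀ v w → T (S v) → T (S w) → number v ≡ number w → w ≡ v ⊎ w ≡ σ v

  numbering : ∀ j (S : Fin m → Bool) → count S ≡ j → (∀ v → T (S v) → T (S (σ v))) → Numbering S
  numbering zero S empty closed = record
    { pairs = 0 ; size = sym empty ; number = λ _ → 0
    ; bounded = λ v Sv → ⊥-elim (count-none S empty v Sv)
    ; classes = λ v _ Sv → ⊥-elim (count-none S empty v Sv) }
  numbering (suc zero) S one closed with count-witness S one
  ... | v , Sv with subst (2 ≤_) one (count-≥2 S (no-fixed-point v ∘ sym) Sv (closed v Sv))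
  ...   | s≤s ()
  numbering (suc (suc j)) S size closed with count-witness S size
  ... | v , Sv = record
    { pairs = suc pairs′ ; size = size-S ; number = number
    ; bounded = bounded ; classes = classes }
    where
    inPair : Fin m → Bool
    inPair = pair v (σ v)
    S′ : Fin m → Bool
    S′ w = S w ∧ not (inPair w)

    pair-members : ∀ {w} → T (inPair w) → w ≡ v ⊎ w ≡ σ v
    pair-members {w} t with T-∨-elim (v == w) t
    ... | inj₁ e = inj₁ (sym (==⇒≡ e))
    ... | inj₂ e = inj₂ (sym (==⇒≡ e))
    pair⊆S : ∀ w → T (inPair w) → T (S w)
    pair⊆S w t with pair-members t
    ... | inj₁ refl = Sv
    ... | inj₂ refl = closed v Sv
    into-S′ : ∀ {w} → T (S w) → ¬ T (inPair w) → T (S′ w)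
    into-S′ Sw ∉pair = Equivalence.from T-∧ (Sw , T-not ∉pair)
    from-S′ : ∀ {w} → T (S′ w) → T (S w) × ¬ T (inPair w)
    from-S′ {w} t with Equivalence.to (T-∧ {S w}) t
    ... | Sw , ∉pair = Sw , not-T ∉pair

    size-S′ : count S′ ≡ j
    size-S′ = +-cancelʳ-≡ 2 _ _
      (trans (cong (count S′ +_) (sym (count-pair (no-fixed-point v ∘ sym))))
             (trans (sym (count-remove S inPair pair⊆S)) (trans size (+-comm 2 j))))
    -- S′ is again σ-closed: σ w lies in the pair only if w does.
    closed′ : ∀ w → T (S′ w) → T (S′ (σ w))
    closed′ w t with from-S′ t
    ... | Sw , ∉pair = into-S′ (closed w Sw) λ σw∈pair → ∉pair (back (pair-members σw∈pair))
      where
      back : σ w ≡ v ⊎ σ w ≡ σ v → T (inPair w)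
      back (inj₁ σw≡v)  = T-∨-introʳ (v == w) (≡⇒== (trans (cong σ (sym σw≡v)) (involutive w)))
      back (inj₂ σw≡σv) = T-∨-introˡ (σ v == w) (≡⇒== (trans (sym (involutive v)) (trans (cong σ (sym σw≡σv)) (involutive w))))

    open Numbering (numbering j S′ size-S′ closed′) renaming
      (pairs to pairs′; size to size′; number to number′; bounded to bounded′; classes to classes′)

    size-S : double (suc pairs′) ≡ count S
    size-S = trans (cong (suc ∘ suc) size′)
                   (trans (+-comm 2 (count S′)) (sym (trans (count-remove S inPair pair⊆S)
                                                        (cong (count S′ +_) (count-pair (no-fixed-point v ∘ sym))))))
    number : Fin m → ℕ
    number w with T? (inPair w)
    ... | yes _ = pairs′
    ... | no  _ = number′ w

    bounded : ∀ w → T (S w) → number w < suc pairs′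
    bounded w Sw with T? (inPair w)
    ... | yes _     = ≤-refl
    ... | no ∉pair = <-trans (bounded′ w (into-S′ Sw ∉pair)) ≤-refl

    classes : ∀ w w′ → T (S w) → T (S w′) → number w ≡ number w′ → w′ ≡ w ⊎ w′ ≡ σ w
    classes w w′ Sw Sw′ same with T? (inPair w) | T? (inPair w′)
    ... | yes w∈ | yes w′∈ with pair-members w∈ | pair-members w′∈
    ...   | inj₁ refl | inj₁ refl = inj₁ refl
    ...   | inj₁ refl | inj₂ refl = inj₂ refl
    ...   | inj₂ refl | inj₁ refl = inj₂ (sym (involutive v))
    ...   | inj₂ refl | inj₂ refl = inj₁ refl
    classes w w′ Sw Sw′ same | yes _ | no ∉pair′ =
      ⊥-elim (<-irrefl (sym same) (bounded′ w′ (into-S′ Sw′ ∉pair′)))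
    classes w w′ Sw Sw′ same | no ∉pair | yes _ =
      ⊥-elim (<-irrefl same (bounded′ w (into-S′ Sw ∉pair)))
    classes w w′ Sw Sw′ same | no ∉pair | no ∉pair′ =
      classes′ w w′ (into-S′ Sw ∉pair) (into-S′ Sw′ ∉pair′) same

  pairing : Σ ℕ λ k → double k ≡ m × Σ (Fin m → Fin k) λ p → ∀ v w → p v ≡ p w → w ≡ v ⊎ w ≡ σ v
  pairing = pairs , trans size (count-all _ (λ _ → tt)) , p , p-classes
    where
    open Numbering (numbering m (λ _ → true) (count-all _ (λ _ → tt)) (λ _ _ → tt))
    p : Fin m → Fin pairs
    p v = fromℕ< (bounded v tt)
    p-classes : ∀ v w → p v ≡ p w → w ≡ v ⊎ w ≡ σ v
    p-classes v w same = classes v w tt tt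
      (trans (sym (toℕ-fromℕ< (bounded v tt))) (trans (cong toℕ same) (toℕ-fromℕ< (bounded w tt))))

-- Small complements.  If the complement of a simple graph H is 0-regular, H
-- is complete and needs m colours; if it is 1-regular, it is a perfect
-- matching and H can be coloured by its m/2 pairs.

complete-colours : ∀ {m k} (H : Graph m) → (∀ u v → u ≢ v → T (H u v)) → Colourable k H → m ≤ k
complete-colours H complete (c , proper) = injective⇒≤ injective
  where
  injective : ∀ {u v} → c u ≡ c v → u ≡ v
  injective {u} {v} same with u ≟ᶠ v
  ... | yes u≡v = u≡v
  ... | no  u≢v = ⊥-elim (proper u v (complete u v u≢v) same)

edgeless-complement : ∀ {m} (H : Graph m) → IsRegular 0 (complement H) → ∀ u v → u ≢ v → T (H u v)
edgeless-complement H regular u v u≢v with T? (H u v)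
... | yes adjacent = adjacent
... | no ¬adjacent = ⊥-elim (count-none (complement H u) (trans (sym (degree≡count (complement H) u)) (regular u))
                                        v (adj-complement H ¬adjacent u≢v))

matching-colourable : ∀ {m} (H : Graph m) → IsSimple H → IsRegular 1 (complement H) →
                      Σ ℕ λ k → double k ≡ m × Colourable k H
matching-colourable {m} H (H-sym , H-loopless) regular = k , k-pairs , p , proper
  where
  Q : Graph m
  Q = complement H
  one : ∀ v → count (Q v) ≡ 1
  one v = trans (sym (degree≡count Q v)) (regular v)
  partner : Fin m → Fin m
  partner v = proj₁ (count-witness (Q v) (one v))
  partner-adj : ∀ v → T (Q v (partner v))
  partner-adj v = proj₂ (count-witness (Q v) (one v))
  Q-simple : IsSimple Q
  Q-simple = complement-simple H H-sym
  no-fixed-point : ∀ v → partner v ≢ v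
  no-fixed-point v e = subst T (proj₂ Q-simple v) (subst (T ∘ Q v) e (partner-adj v))
  involutive : ∀ v → partner (partner v) ≡ v
  involutive v = count-unique (Q (partner v)) (one (partner v))
    (partner-adj (partner v)) (subst T (proj₁ Q-simple v (partner v)) (partner-adj v))
  open Pairing partner no-fixed-point involutive using (pairing)
  k : ℕ
  k = proj₁ pairing
  k-pairs : double k ≡ m
  k-pairs = proj₁ (proj₂ pairing)
  p : Fin m → Fin k
  p = proj₁ (proj₂ (proj₂ pairing))
  proper : ∀ u v → T (H u v) → p u ≢ p v
  proper u v adjacent same with proj₂ (proj₂ (proj₂ pairing)) u v same
  ... | inj₁ refl = subst T (H-loopless u) adjacent
  ... | inj₂ refl = proj₁ (complement-adj H (partner-adj u)) adjacent

-- The order bound.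
order-bound : ∀ r χ → χ ≤ r → r + 3 ≤ double χ → ∀ m (H : Graph m) → IsRChiGraph r χ H → r + 3 ≤ m
order-bound r χ χ≤r r+3≤2χ zero H (_ , _ , _ , minimal) with minimal 0 ((λ ()) , λ ())
... | z≤n with subst (_≤ 0) (+-comm r 3) r+3≤2χ
...   | ()
order-bound r χ χ≤r r+3≤2χ m@(suc _) H (simple , regular , colourable , minimal) = by-degree d refl
  where
  Q : Graph m
  Q = complement H
  d : ℕ
  d = degree Q fzero
  degree+ : ∀ v → degree Q v + (r + 1) ≡ m
  degree+ = complement-regular H simple regular
  Q-regular : IsRegular d Q
  Q-regular v = +-cancelʳ-≡ (r + 1) _ _ (trans (degree+ v) (sym (degree+ fzero)))
  by-degree : ∀ e → d ≡ e → r + 3 ≤ m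
  by-degree zero d≡0 =
    ⊥-elim (<-irrefl refl (subst (_≤ r) m≡1+r (≤-trans (complete-colours H complete colourable) χ≤r)))
    where
    complete : ∀ u v → u ≢ v → T (H u v)
    complete = edgeless-complement H (λ v → trans (Q-regular v) d≡0)
    m≡1+r : m ≡ suc r
    m≡1+r = trans (sym (degree+ fzero)) (trans (cong (_+ (r + 1)) d≡0) (+-comm r 1))
  by-degree (suc zero) d≡1 = ⊥-elim (<-irrefl refl (≤-pred (≤-pred (begin
    3 + r       ≡⟨ +-comm 3 r ⟩
    r + 3       ≤⟨ r+3≤2χ ⟩
    double χ    ≤⟨ double-mono (minimal k colouring) ⟩
    double k    ≡⟨ 2k≡m ⟩
    m           ≡⟨ sym (degree+ fzero) ⟩
    d + (r + 1) ≡⟨ cong (λ x → x + (r + 1)) d≡1 ⟩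
    1 + (r + 1) ≡⟨ cong suc (+-comm r 1) ⟩
    2 + r       ∎))))
    where
    open ≤-Reasoning
    halves : Σ ℕ λ k → double k ≡ m × Colourable k H
    halves = matching-colourable H simple (λ v → trans (Q-regular v) d≡1)
    k : ℕ
    k = proj₁ halves
    2k≡m : double k ≡ m
    2k≡m = proj₁ (proj₂ halves)
    colouring : Colourable k H
    colouring = proj₂ (proj₂ halves)
  by-degree (suc (suc e)) d≡2+e = begin
    r + 3             ≡⟨ +-comm r 3 ⟩
    3 + r             ≤⟨ s≤s (s≤s (m≤n+m (suc r) e)) ⟩
    2 + e + (1 + r)   ≡⟨ cong₂ _+_ (sym d≡2+e) (+-comm 1 r) ⟩
    d + (r + 1)       ≡⟨ degree+ fzero ⟩
    m                 ∎
    where open ≤-Reasoning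

-- Counting cycle lengths.  Pairing the lengths
-- 2j + 3 and 2j + 4 gives 2·κ = i for even i, 2·κ = i + 1 for odd i ≥ 5 and
-- 2·κ = i - 1 for i = 3, whence 2·χ + a_3 = n + (a_5 + a_7 + … + a_{2t-1}).

∑< : ℕ → (ℕ → ℕ) → ℕ
∑< n f = sum (applyUpTo f n)

∑<-cong : ∀ n {f g : ℕ → ℕ} → (∀ k → f k ≡ g k) → ∑< n f ≡ ∑< n g
∑<-cong zero    f≗g = refl
∑<-cong (suc n) f≗g = cong₂ _+_ (f≗g 0) (∑<-cong n (f≗g ∘ suc))

∑<-+ : ∀ n (f g : ℕ → ℕ) → ∑< n (λ k → f k + g k) ≡ ∑< n f + ∑< n g
∑<-+ zero    f g = refl
∑<-+ (suc n) f g = trans (cong (f 0 + g 0 +_) (∑<-+ n (f ∘ suc) (g ∘ suc))) (+-comm-middle (f 0) (g 0) _ _)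
  where
  +-comm-middle : ∀ a b c d → a + b + (c + d) ≡ a + c + (b + d)
  +-comm-middle = solve-∀

∑<-double : ∀ n (f : ℕ → ℕ) → double (∑< n f) ≡ ∑< n (double ∘ f)
∑<-double zero    f = refl
∑<-double (suc n) f = trans (double-+ (f 0) (∑< n (f ∘ suc))) (cong (double (f 0) +_) (∑<-double n (f ∘ suc)))

∑<-pairs : ∀ s (f : ℕ → ℕ) → ∑< (double s) f ≡ ∑< s (λ j → f (double j) + f (suc (double j)))
∑<-pairs zero    f = refl
∑<-pairs (suc s) f = trans (cong (λ x → f 0 + (f 1 + x)) (∑<-pairs s (f ∘ suc ∘ suc))) (sym (+-assoc (f 0) (f 1) _))

sum-copies : ∀ (a f : ℕ → ℕ) xs → sum (map f (concatMap (λ i → replicate (a i) i) xs)) ≡ sum (map (λ i → a i * f i) xs)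
sum-copies a f []       = refl
sum-copies a f (x ∷ xs) = begin
  sum (map f (replicate (a x) x ++ concatMap (λ i → replicate (a i) i) xs))
    ≡⟨ cong sum (map-++ f (replicate (a x) x) _) ⟩
  sum (map f (replicate (a x) x) ++ map f (concatMap (λ i → replicate (a i) i) xs))
    ≡⟨ sum-++ (map f (replicate (a x) x)) _ ⟩
  sum (map f (replicate (a x) x)) + sum (map f (concatMap (λ i → replicate (a i) i) xs))
    ≡⟨ cong₂ _+_ (sum-replicate (a x)) (sum-copies a f xs) ⟩
  a x * f x + sum (map (λ i → a i * f i) xs) ∎
  where
  open ≡-Reasoning
  sum-replicate : ∀ k → sum (map f (replicate k x)) ≡ k * f x
  sum-replicate zero    = refl
  sum-replicate (suc k) = cong (f x +_) (sum-replicate k)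

sum-cycleLengths : ∀ t a (f : ℕ → ℕ) →
                   sum (map f (cycleLengths t a)) ≡ ∑< (2 * t ∸ 2) (λ k → a (3 + k) * f (3 + k))
sum-cycleLengths t a f = begin
  sum (map f (cycleLengths t a))
    ≡⟨ sum-copies a f (map (3 +_) (upTo N)) ⟩
  sum (map (λ i → a i * f i) (map (3 +_) (upTo N)))
    ≡⟨ cong sum (sym (map-∘ {g = λ i → a i * f i} {f = 3 +_} (upTo N))) ⟩
  sum (map (λ k → a (3 + k) * f (3 + k)) (upTo N))
    ≡⟨ cong sum (map-upTo (λ k → a (3 + k) * f (3 + k)) N) ⟩
  ∑< N (λ k → a (3 + k) * f (3 + k)) ∎
  where
  open ≡-Reasoning
  N = 2 * t ∸ 2

cycleLengths-≥3 : ∀ t a → All (3 ≤_) (cycleLengths t a)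
cycleLengths-≥3 t a =
  concat⁺ (map⁺ (map⁺ (applyUpTo⁺₂ id (2 * t ∸ 2) (λ k → replicate⁺ (a (3 + k)) (m≤m+n 3 k)))))

order-cycleLengths : ∀ t a → sum (cycleLengths t a) ≡ order t a
order-cycleLengths t a = begin
  sum (cycleLengths t a)                             ≡⟨ cong sum (sym (map-id (cycleLengths t a))) ⟩
  sum (map id (cycleLengths t a))                    ≡⟨ sum-cycleLengths t a id ⟩
  ∑< (2 * t ∸ 2) (λ k → a (3 + k) * (3 + k))          ≡⟨ ∑<-cong (2 * t ∸ 2) (λ k → *-comm (a (3 + k)) (3 + k)) ⟩
  ∑< (2 * t ∸ 2) (λ k → (3 + k) * a (3 + k))          ≡⟨ cong sum (sym (map-upTo _ (2 * t ∸ 2))) ⟩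
  order t a ∎
  where open ≡-Reasoning

cover-identity : ∀ s a → let t = suc (suc s) in
                 double (coverNumber (cycleLengths t a)) + a 3 ≡ order t a + oddSum t a
cover-identity s a = begin
  double (coverNumber (cycleLengths t a)) + a 3
    ≡⟨ cong (λ x → double x + a 3) (trans (sum-cycleLengths t a κ) (cong (λ N → ∑< N F) range)) ⟩
  double (∑< (double (suc s)) F) + a 3
    ≡⟨ cong (λ x → double x + a 3) (∑<-pairs (suc s) F) ⟩
  double (pairF 0 + ∑< s (pairF ∘ suc)) + a 3
    ≡⟨ cong (_+ a 3) (double-+ (pairF 0) _) ⟩
  double (pairF 0) + double (∑< s (pairF ∘ suc)) + a 3
    ≡⟨ +-comm-right (double (pairF 0)) _ (a 3) ⟩
  double (pairF 0) + a 3 + double (∑< s (pairF ∘ suc))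
    ≡⟨ cong₂ _+_ (first-pair (a 3) (a 4)) (trans (∑<-double s (pairF ∘ suc)) (∑<-cong s later-pair)) ⟩
  pairG 0 + ∑< s (λ i → pairG (suc i) + oddTerm i)
    ≡⟨ cong (pairG 0 +_) (∑<-+ s (pairG ∘ suc) oddTerm) ⟩
  pairG 0 + (∑< s (pairG ∘ suc) + ∑< s oddTerm)
    ≡⟨ sym (+-assoc (pairG 0) _ _) ⟩
  ∑< (suc s) pairG + ∑< s oddTerm
    ≡⟨ cong₂ _+_ (trans (sym (∑<-pairs (suc s) G)) (cong (λ N → ∑< N G) (sym range)))
                 (cong sum (sym (map-upTo oddTerm s))) ⟩
  ∑< (2 * t ∸ 2) G + oddSum t a
    ≡⟨ cong (_+ oddSum t a) (cong sum (sym (map-upTo G (2 * t ∸ 2)))) ⟩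
  order t a + oddSum t a ∎
  where
  open ≡-Reasoning
  t = suc (suc s)
  F G : ℕ → ℕ
  F k = a (3 + k) * κ (3 + k)
  G k = (3 + k) * a (3 + k)
  oddTerm : ℕ → ℕ
  oddTerm k = a (5 + 2 * k)
  pairF pairG : ℕ → ℕ
  pairF j = F (double j) + F (suc (double j))
  pairG j = G (double j) + G (suc (double j))
  2*≡double : ∀ n → 2 * n ≡ double n
  2*≡double n = trans (cong (n +_) (+-identityʳ n)) (sym (double≡+ n))
  range : 2 * t ∸ 2 ≡ double (suc s)
  range = cong (_∸ 2) (2*≡double t)
  +-comm-right : ∀ x y z → x + y + z ≡ x + z + y
  +-comm-right = solve-∀
  -- lengths 3 and 4: 2·(a₃·1 + a₄·2) + a₃ = 3a₃ + 4a₄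
  first-pair : ∀ a₃ a₄ → double (a₃ * 1 + a₄ * 2) + a₃ ≡ 3 * a₃ + 4 * a₄
  first-pair a₃ a₄ rewrite double≡+ (a₃ * 1 + a₄ * 2) = ring a₃ a₄
    where
    ring : ∀ a₃ a₄ → a₃ * 1 + a₄ * 2 + (a₃ * 1 + a₄ * 2) + a₃ ≡ 3 * a₃ + 4 * a₄
    ring = solve-∀
  -- lengths 2i + 5 and 2i + 6, both with κ = i + 3
  pair-identity : ∀ A B i → double (A * (3 + i) + B * (3 + i)) ≡ (5 + double i) * A + (6 + double i) * B + A
  pair-identity A B i rewrite double≡+ (A * (3 + i) + B * (3 + i)) | double≡+ i = ring A B i
    where
    ring : ∀ A B i → A * (3 + i) + B * (3 + i) + (A * (3 + i) + B * (3 + i)) ≡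
                     (5 + (i + i)) * A + (6 + (i + i)) * B + A
    ring = solve-∀
  later-pair : ∀ i → double (pairF (suc i)) ≡ pairG (suc i) + oddTerm i
  later-pair i rewrite ⌈odd/2⌉ i | ⌈double/2⌉ i | 2*≡double i = pair-identity (a (5 + double i)) (a (6 + double i)) i

half-bound : ∀ n χ → 6 ≤ n → n ≤ double χ → double χ ≤ suc n → χ + 3 ≤ n
half-bound n 0 6≤n n≤2χ _ with ≤-trans 6≤n n≤2χ
... | ()
half-bound n 1 6≤n n≤2χ _ with ≤-trans 6≤n n≤2χ
... | s≤s (s≤s ())
half-bound n 2 6≤n n≤2χ _ with ≤-trans 6≤n n≤2χ
... | s≤s (s≤s (s≤s (s≤s ())))
half-bound n 3 6≤n _ _ = 6≤n
half-bound n χ@(suc (suc (suc (suc c)))) _ _ 2χ≤1+n = begin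
  χ + 3            ≡⟨ +-comm χ 3 ⟩
  7 + c            ≤⟨ +-monoʳ-≤ 7 (subst (c ≤_) (sym (double≡+ c)) (m≤m+n c c)) ⟩
  7 + double c     ≤⟨ ≤-pred 2χ≤1+n ⟩
  n                ∎
  where open ≤-Reasoning

cycles-complement-extremal : ∀ {ls} → All (3 ≤_) ls → 6 ≤ sum ls →
                             sum ls ≤ double (coverNumber ls) → double (coverNumber ls) ≤ suc (sum ls) →
                             IsExtremal (sum ls ∸ 3) (coverNumber ls) (complement (cycles ls))
cycles-complement-extremal {ls} 3≤ls 6≤n n≤2χ 2χ≤1+n =
  (complement-simple G (cycles-symmetric ls) , regular ,
   complement-chromatic G (proj₂ (cycles-cover 3≤ls)) (cycles-forces 3≤ls)) ,
  λ m H H-rχ → subst (_≤ m) r+3≡n (order-bound r χ χ≤r (subst (_≤ double χ) (sym r+3≡n) n≤2χ) m H H-rχ)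
  where
  G = cycles ls
  n = sum ls
  χ = coverNumber ls
  r = n ∸ 3
  r+3≡n : r + 3 ≡ n
  r+3≡n = m∸n+n≡m (≤-trans (s≤s (s≤s (s≤s z≤n))) 6≤n)
  χ≤r : χ ≤ r
  χ≤r = m+n≤o⇒m≤o∸n χ (half-bound n χ 6≤n n≤2χ 2χ≤1+n)
  regular : IsRegular r (complement G)
  regular v = trans (sym (m+n∸n≡m _ 3))
    (cong (_∸ 3) (complement-regular G (cycles-symmetric ls , cycles-loopless 3≤ls) (cycles-regular 3≤ls) v))

theorem5 : (t : ℕ) → 2 ≤ t → (a : ℕ → ℕ) → 6 ≤ order t a →
           ((order t a % 2 ≡ 0 → oddSum t a ≡ a 3 →
               ∃[ r ] ∃[ χ ] IsExtremal r χ (complement (cycles (cycleLengths t a))))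
          × (order t a % 2 ≡ 1 → oddSum t a ≡ a 3 + 1 →
               ∃[ r ] ∃[ χ ] IsExtremal r χ (complement (cycles (cycleLengths t a)))))
theorem5 t@(suc (suc s)) _ a 6≤n =
  (λ _ balanced → extremal (≤-reflexive (sym (2χ≡n balanced))) (≤-trans (≤-reflexive (2χ≡n balanced)) (n≤1+n n))) ,
  (λ _ balanced → extremal (≤-trans (n≤1+n n) (≤-reflexive (sym (2χ≡1+n balanced)))) (≤-reflexive (2χ≡1+n balanced)))
  where
  ls = cycleLengths t a
  n = sum ls
  χ = coverNumber ls
  identity : double χ + a 3 ≡ n + oddSum t a
  identity = trans (cover-identity s a) (cong (_+ oddSum t a) (sym (order-cycleLengths t a)))
  2χ≡n : oddSum t a ≡ a 3 → double χ ≡ n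
  2χ≡n balanced = +-cancelʳ-≡ (a 3) _ _ (trans identity (cong (n +_) balanced))
  2χ≡1+n : oddSum t a ≡ a 3 + 1 → double χ ≡ suc n
  2χ≡1+n balanced = +-cancelʳ-≡ (a 3) _ _
    (trans identity (trans (cong (n +_) (trans balanced (+-comm (a 3) 1))) (+-suc n (a 3))))
  extremal : n ≤ double χ → double χ ≤ suc n → ∃[ r ] ∃[ χ ] IsExtremal r χ (complement (cycles ls))
  extremal n≤2χ 2χ≤1+n = _ , _ ,
    cycles-complement-extremal (cycleLengths-≥3 t a) (subst (6 ≤_) (sym (order-cycleLengths t a)) 6≤n) n≤2χ 2χ≤1+n
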